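{- In the coproduct construction of the context: every $\alpha\in\mathsf{con}_\wedge$ (resp. $\alpha\in\mathsf{tot}_\wedge$) is of the form $(\bigwedge_{i\in\mathcal I}\alpha^i_+,\bigvee_{i\in\mathcal I}\alpha^i_-)$ where (1) for every $i\in\mathcal I$, $\alpha^i=(a_+\oplus_i\mathbf 1,a_-\oplus_i\mathbf 1)$ for some $(a_+,a_-)\in\mathsf{con}^i$ (resp. $\mathsf{tot}^i$), and (2) there is a finite $I(\alpha)\subseteq\mathcal I$ such that $i\in I(\alpha)$ iff $\alpha^i\ne tt$. Similarly, every $\alpha\in\mathsf{con}_\vee$ (resp. $\mathsf{tot}_\vee$) is of the form $(\bigvee_{i\in\mathcal I}\alpha^i_+,\bigwedge_{i\in\mathcal I}\alpha^i_-)$ where each $\alpha^i\in\mathsf{con}_1$ (resp. $\mathsf{tot}_1$) is of the form $(a_+\oplus_i\mathbf 1,a_-\oplus_i\mathbf 1)$ with $(a_+,a_-)\in\mathsf{con}^i$ (resp. $\mathsf{tot}^i$), and the set $I(\alpha)$ of indices with $\alpha^i\ne ff$ is finite.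
   Context: Let $\{(L^i_+,L^i_-;\mathsf{con}^i,\mathsf{tot}^i)\}_{i\in\mathcal I}$ be a family of d-frames (frames $L^i_\pm$ with relations $\mathsf{con}^i,\mathsf{tot}^i\subseteq L^i_+\times L^i_-$ satisfying the d-frame axioms: $\mathsf{con}$ downward and $\mathsf{tot}$ upward closed in the coordinatewise order, both containing $(1,0),(0,1)$ and closed under logical $\wedge,\vee$, $\mathsf{con}$ closed under directed coordinatewise joins, and (con-tot)). For $\pm\in\{+,-\}$ let $B_\pm$ be the set of elements of $\prod_iL^i_\pm$ with all but finitely many coordinates $1$, $\mathbf 1$ its top; for $a\in L^j_\pm$, $u\in B_\pm$, $a*_ju$ has $j$-th coordinate $a$ and others $u_i$. $\mathcal C_\pm$ consists of all $\{a^k*_ju:k\in K\}\dashv(\bigvee_ka^k)*_ju$. $\bigoplus_iL^i_\pm$ is the frame (under inclusion) of $\mathcal C_\pm$-ideals, i.e. downsets $I\subseteq B_\pm$ with $U\dashv a\in\mathcal C_\pm,U\subseteq I\Rightarrow a\in I$. $\mathbf n_\pm=\{u: u_i=0\text{ for some }i\}$ and $a\oplus_ju=\downarrow(a*_ju)\cup\mathbf n_\pm$. $\mathsf{con}_1=\{(a\oplus_j\mathbf 1,b\oplus_j\mathbf 1):j\in\mathcal I,(a,b)\in\mathsf{con}^j\}$, $\mathsf{tot}_1$ analogously. On $\bigoplus_iL^i_+\times\bigoplus_iL^i_-$: logical join $(\alpha_+\vee\beta_+,\alpha_-\wedge\beta_-)$, meet $(\alpha_+\wedge\beta_+,\alpha_-\vee\beta_-)$,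 $tt=(1,0)$, $ff=(0,1)$. $\mathsf{con}_\wedge,\mathsf{con}_\vee$ (resp. $\mathsf{tot}_\wedge,\mathsf{tot}_\vee$) are the closures of $\mathsf{con}_1$ (resp. $\mathsf{tot}_1$) under finite logical meets, resp. joins. -}

module Defs where

open import Level using (Level; 0ℓ; Lift; lift; lower) renaming (suc to lsuc)
open import Data.Bool using (Bool; true; false; if_then_else_)
open import Data.Empty using (⊥)
open import Data.Unit using (⊤)
open import Data.Product using (Σ; Σ-syntax; _×_; _,_; proj₁; proj₂)
open import Data.Sum using (_⊎_; inj₁; inj₂)
open import Data.List using (List; []; _∷_)
open import Data.List.Membership.Propositional using (_∈_; _∉_)
open import Data.List.Relation.Unary.Any using (here; there)
open import Relation.Nullary using (¬_; Dec; yes; no)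
open import Relation.Nullary.Decidable using (map′)
open import Relation.Binary.PropositionalEquality using (_≡_; refl)
open import Relation.Binary.Definitions using (DecidableEquality)
open import Function using (_⇔_)
open import Axiom.ExcludedMiddle using (ExcludedMiddle)

record Frame : Set₁ where
  field
    Carrier   : Set
    _≤_       : Carrier → Carrier → Set
    ≤-refl    : ∀ {a} → a ≤ a
    ≤-trans   : ∀ {a b c} → a ≤ b → b ≤ c → a ≤ c
    ≤-antisym : ∀ {a b} → a ≤ b → b ≤ a → a ≡ b
    top       : Carrier
    bot       : Carrier
    top-max   : ∀ {a} → a ≤ top
    bot-min   : ∀ {a} → bot ≤ a
    _∧_       : Carrier → Carrier → Carrier
    ∧-lb₁     : ∀ {a b} → (a ∧ b) ≤ a
    ∧-lb₂     : ∀ {a b} → (a ∧ b) ≤ b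
    ∧-glb     : ∀ {a b c} → c ≤ a → c ≤ b → c ≤ (a ∧ b)
    ⋁         : {K : Set} → (K → Carrier) → Carrier
    ⋁-ub      : ∀ {K : Set} (f : K → Carrier) (k : K) → f k ≤ ⋁ f
    ⋁-lub     : ∀ {K : Set} (f : K → Carrier) {c} → (∀ k → f k ≤ c) → ⋁ f ≤ c
    distrib   : ∀ {K : Set} (a : Carrier) (f : K → Carrier) →
                (a ∧ ⋁ f) ≡ ⋁ (λ k → a ∧ f k)

  _∨_ : Carrier → Carrier → Carrier
  a ∨ b = ⋁ (λ (x : Bool) → if x then a else b)

record DFrame : Set₁ where
  field
    L₊ L₋ : Frame
  open Frame L₊ renaming (Carrier to C₊; _≤_ to _≤₊_; top to 1₊; bot to 0₊; _∧_ to _∧₊_; _∨_ to _∨₊_; ⋁ to ⋁₊)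
  open Frame L₋ renaming (Carrier to C₋; _≤_ to _≤₋_; top to 1₋; bot to 0₋; _∧_ to _∧₋_; _∨_ to _∨₋_; ⋁ to ⋁₋)
  field
    con tot : C₊ → C₋ → Set
    con-↓ : ∀ {a b a' b'} → con a b → a' ≤₊ a → b' ≤₋ b → con a' b'
    tot-↑ : ∀ {a b a' b'} → tot a b → a ≤₊ a' → b ≤₋ b' → tot a' b'
    con-tt : con 1₊ 0₋
    con-ff : con 0₊ 1₋
    tot-tt : tot 1₊ 0₋
    tot-ff : tot 0₊ 1₋
    con-∧ : ∀ {a b c d} → con a b → con c d → con (a ∧₊ c) (b ∨₋ d)
    con-∨ : ∀ {a b c d} → con a b → con c d → con (a ∨₊ c) (b ∧₋ d)
    tot-∧ : ∀ {a b c d} → tot a b → tot c d → tot (a ∧₊ c) (b ∨₋ d)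
    tot-∨ : ∀ {a b c d} → tot a b → tot c d → tot (a ∨₊ c) (b ∧₋ d)
    con-dir : ∀ {K : Set} (f : K → C₊ × C₋) →
              K →
              (∀ k l → Σ[ m ∈ K ] ((proj₁ (f k) ≤₊ proj₁ (f m)) × (proj₂ (f k) ≤₋ proj₂ (f m))
                                  × (proj₁ (f l) ≤₊ proj₁ (f m)) × (proj₂ (f l) ≤₋ proj₂ (f m)))) →
              (∀ k → con (proj₁ (f k)) (proj₂ (f k))) →
              con (⋁₊ (λ k → proj₁ (f k))) (⋁₋ (λ k → proj₂ (f k)))
    con-tot : ∀ {a b c d} → con a b → tot c d → (a ≡ c ⊎ b ≡ d) → (a ≤₊ c) × (b ≤₋ d)

-- The frame ⊕_i F_i of C-ideals (for one polarity).  Subsets of B are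
-- predicates B → Set₁; equality of ideals is mutual inclusion.

module Sum (𝓘 : Set) (_≟_ : DecidableEquality 𝓘) (F : 𝓘 → Frame) where
  open Frame

  Elt : Set
  Elt = (i : 𝓘) → Carrier (F i)

  CofinTop : Elt → Set
  CofinTop u = Σ[ S ∈ List 𝓘 ] (∀ i → i ∉ S → u i ≡ top (F i))

  B : Set
  B = Σ Elt CofinTop

  _≤B_ : B → B → Set
  u ≤B v = ∀ i → _≤_ (F i) (proj₁ u i) (proj₁ v i)

  𝟏 : B
  𝟏 = (λ i → top (F i)) , ([] , λ i _ → refl)

  upd : (j : 𝓘) → Carrier (F j) → Elt → Elt
  upd j a u i with i ≟ j
  ... | yes refl = a
  ... | no _     = u i

  private
    upd-cofin : (j : 𝓘) (a : Carrier (F j)) (u : B) → CofinTop (upd j a (proj₁ u))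
    upd-cofin j a (u , S , p) = j ∷ S , q
      where
      q : ∀ i → i ∉ (j ∷ S) → upd j a u i ≡ top (F i)
      q i i∉ with i ≟ j
      ... | yes refl = Data.Empty.⊥-elim (i∉ (here refl))
        where import Data.Empty
      ... | no _     = p i (λ i∈ → i∉ (there i∈))

  _*[_]_ : {j : 𝓘} → Carrier (F j) → (j' : 𝓘) → B → B
  _*[_]_ {j} a _ u = upd j a (proj₁ u) , upd-cofin j a u

  Sub : Set₂
  Sub = B → Set₁

  _⊆_ : Sub → Sub → Set₁
  I ⊆ J = ∀ u → I u → J u

  _≐_ : Sub → Sub → Set₁
  I ≐ J = (I ⊆ J) × (J ⊆ I)

  IsCIdeal : Sub → Set₁
  IsCIdeal I = (∀ u v → u ≤B v → I v → I u)
             × (∀ (j : 𝓘) {K : Set} (a : K → Carrier (F j)) (u : B) →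
                  (∀ k → I (_*[_]_ {j} (a k) j u)) → I (_*[_]_ {j} (⋁ (F j) a) j u))

  data Gen (S : Sub) : B → Set₁ where
    base  : ∀ {u} → S u → Gen S u
    down  : ∀ {u v} → u ≤B v → Gen S v → Gen S u
    cover : (j : 𝓘) {K : Set} (a : K → Carrier (F j)) (u : B) →
            (∀ k → Gen S (_*[_]_ {j} (a k) j u)) → Gen S (_*[_]_ {j} (⋁ (F j) a) j u)

  𝟙 : Sub
  𝟙 _ = Lift _ ⊤

  𝟘 : Sub
  𝟘 = Gen (λ _ → Lift _ ⊥)

  _⊓_ : Sub → Sub → Sub
  (I ⊓ J) u = I u × J u

  _⊔_ : Sub → Sub → Sub
  I ⊔ J = Gen (λ u → I u ⊎ J u)

  ⋀ᵢ : (𝓘 → Sub) → Sub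
  ⋀ᵢ f u = ∀ i → f i u

  ⋁ᵢ : (𝓘 → Sub) → Sub
  ⋁ᵢ f = Gen (λ u → Σ[ i ∈ 𝓘 ] f i u)

  𝐧 : Sub
  𝐧 u = Lift _ (Σ[ i ∈ 𝓘 ] proj₁ u i ≡ bot (F i))

  ↓ : B → Sub
  ↓ v u = Lift _ (u ≤B v)

  _⊕[_]_ : {j : 𝓘} → Carrier (F j) → (j' : 𝓘) → B → Sub
  _⊕[_]_ {j} a _ u w = ↓ (_*[_]_ {j} a j u) w ⊎ 𝐧 w

module Coproduct (𝓘 : Set) (_≟_ : DecidableEquality 𝓘) (L : 𝓘 → DFrame) where
  module P = Sum 𝓘 _≟_ (λ i → DFrame.L₊ (L i))
  module N = Sum 𝓘 _≟_ (λ i → DFrame.L₋ (L i))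

  C₊ C₋ : 𝓘 → Set
  C₊ i = Frame.Carrier (DFrame.L₊ (L i))
  C₋ i = Frame.Carrier (DFrame.L₋ (L i))

  Pair : Set₂
  Pair = P.Sub × N.Sub

  _≐ₚ_ : Pair → Pair → Set₁
  α ≐ₚ β = (proj₁ α P.≐ proj₁ β) × (proj₂ α N.≐ proj₂ β)

  _∧ₗ_ _∨ₗ_ : Pair → Pair → Pair
  α ∧ₗ β = (proj₁ α P.⊓ proj₁ β) , (proj₂ α N.⊔ proj₂ β)
  α ∨ₗ β = (proj₁ α P.⊔ proj₁ β) , (proj₂ α N.⊓ proj₂ β)

  ttₗ ffₗ : Pair
  ttₗ = P.𝟙 , N.𝟘
  ffₗ = P.𝟘 , N.𝟙

  inj : (j : 𝓘) → C₊ j → C₋ j → Pair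
  inj j a b = P._⊕[_]_ {j} a j P.𝟏 , N._⊕[_]_ {j} b j N.𝟏

  -- R stands for con or tot (a relation on each L^i)
  Rel : Set₁
  Rel = (i : 𝓘) → C₊ i → C₋ i → Set

  data R₁ (R : Rel) : Pair → Set₂ where
    mk : (j : 𝓘) (a : C₊ j) (b : C₋ j) → R j a b → R₁ R (inj j a b)

  data R∧ (R : Rel) : Pair → Set₂ where
    one  : ∀ {α} → R₁ R α → R∧ R α
    tt   : R∧ R ttₗ
    meet : ∀ {α β} → R∧ R α → R∧ R β → R∧ R (α ∧ₗ β)

  data R∨ (R : Rel) : Pair → Set₂ where
    one  : ∀ {α} → R₁ R α → R∨ R α
    ff   : R∨ R ffₗ
    join : ∀ {α β} → R∨ R α → R∨ R β → R∨ R (α ∨ₗ β)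

  conR totR : Rel
  conR i = DFrame.con (L i)
  totR i = DFrame.tot (L i)

  RepMeet : Rel → Pair → Set₁
  RepMeet R α =
    Σ[ a₊ ∈ ((i : 𝓘) → C₊ i) ] Σ[ a₋ ∈ ((i : 𝓘) → C₋ i) ]
      (∀ i → R i (a₊ i) (a₋ i))
      × (α ≐ₚ (P.⋀ᵢ (λ i → proj₁ (inj i (a₊ i) (a₋ i))) , N.⋁ᵢ (λ i → proj₂ (inj i (a₊ i) (a₋ i)))))
      × (Σ[ I ∈ List 𝓘 ] (∀ i → (i ∈ I) ⇔ (¬ (inj i (a₊ i) (a₋ i) ≐ₚ ttₗ))))

  RepJoin : Rel → Pair → Set₁
  RepJoin R α =
    Σ[ a₊ ∈ ((i : 𝓘) → C₊ i) ] Σ[ a₋ ∈ ((i : 𝓘) → C₋ i) ]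
      (∀ i → R i (a₊ i) (a₋ i))
      × (α ≐ₚ (P.⋁ᵢ (λ i → proj₁ (inj i (a₊ i) (a₋ i))) , N.⋀ᵢ (λ i → proj₂ (inj i (a₊ i) (a₋ i)))))
      × (Σ[ I ∈ List 𝓘 ] (∀ i → (i ∈ I) ⇔ (¬ (inj i (a₊ i) (a₋ i) ≐ₚ ffₗ))))

emDecEq : ExcludedMiddle (lsuc 0ℓ) → (𝓘 : Set) → DecidableEquality 𝓘
emDecEq em 𝓘 i j = map′ lower lift (em {P = Lift (lsuc 0ℓ) (i ≡ j)})

-- Each generator (a₊ ⊕ᵢ 𝟏, a₋ ⊕ᵢ 𝟏) of con₁ is the meet over all indices of the family that
-- is (a₊, a₋) at i and (1, 0) elsewhere, and dually the join of the family that is (0, 1)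
-- elsewhere. The ideals a ⊕ᵢ 𝟏 turn the frame operations of Lⁱ into those of the
-- coproduct: (a ⊕ᵢ 𝟏) ∩ (b ⊕ᵢ 𝟏) = (a ∧ b) ⊕ᵢ 𝟏, (a ⊕ᵢ 𝟏) ⊔ (b ⊕ᵢ 𝟏) = (a ∨ b) ⊕ᵢ 𝟏,
-- 1 ⊕ᵢ 𝟏 = 1 and 0 ⊕ᵢ 𝟏 = 0. Hence a logical meet (join) of two represented pairs is
-- represented by the coordinatewise logical meet (join) of the families, which stays in
-- con/tot by the d-frame axioms, and the support grows by a finite union. The main
-- ingredient is that a ⊕ᵢ 𝟏 is itself a C-ideal, which needs excluded middle to locate zero
-- coordinates; excluded middle also cuts the finite support down to the exact set I(α).

module Submission where

open import Defs
open import Level using (0ℓ; lift; lower) renaming (suc to lsuc)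
open import Data.Bool using (true; false; if_then_else_)
open import Data.Empty using (⊥; ⊥-elim)
open import Data.Product using (_×_; Σ-syntax; _,_; proj₁; proj₂)
open import Data.Sum using (_⊎_; inj₁; inj₂)
open import Data.List using (List; []; _∷_; _++_; filter)
open import Data.List.Membership.Propositional using (_∈_; _∉_)
open import Data.List.Membership.Propositional.Properties
  using (∈-++⁺ˡ; ∈-++⁺ʳ; ∈-filter⁺; ∈-filter⁻)
import Data.List.Membership.DecPropositional as DecMembership
open import Data.List.Relation.Unary.Any using (here)
open import Relation.Nullary using (¬_; Dec; yes; no)
open import Relation.Nullary.Decidable using (map′)
open import Relation.Binary.PropositionalEquality
  using (_≡_; refl; sym; trans; cong₂; subst; subst₂; ≢-sym)
open import Relation.Binary.Definitions using (DecidableEquality)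
open import Function using (_⇔_; mk⇔)
open import Axiom.ExcludedMiddle using (ExcludedMiddle)

lowerExcludedMiddle : ∀ {ℓ} → ExcludedMiddle (lsuc ℓ) → ExcludedMiddle ℓ
lowerExcludedMiddle em = map′ lower lift em

bounded⇒enumerable : ∀ {ℓ} → ExcludedMiddle ℓ → {A : Set} (Q : A → Set ℓ) (S : List A) →
                     (∀ x → Q x → x ∈ S) → Σ[ I ∈ List A ] (∀ x → (x ∈ I) ⇔ Q x)
bounded⇒enumerable em Q S Q⊆S =
  filter Q? S ,
  λ x → mk⇔ (λ x∈I → proj₂ (∈-filter⁻ Q? {xs = S} x∈I)) (λ q → ∈-filter⁺ Q? (Q⊆S x q) q)
  where
  Q? = λ x → em {P = Q x}

module FrameProperties (F : Frame) where
  open Frame F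

  ≤bot⇒≡bot : ∀ {a} → a ≤ bot → a ≡ bot
  ≤bot⇒≡bot a≤bot = ≤-antisym a≤bot bot-min

  top∧top : top ∧ top ≡ top
  top∧top = ≤-antisym top-max (∧-glb ≤-refl ≤-refl)

  bot∨bot : bot ∨ bot ≡ bot
  bot∨bot = ≤bot⇒≡bot (⋁-lub _ λ { true → ≤-refl ; false → ≤-refl })

  ⋁-bot : ∀ {K : Set} (f : K → Carrier) → (∀ k → f k ≡ bot) → ⋁ f ≡ bot
  ⋁-bot f fk≡bot = ≤bot⇒≡bot (⋁-lub f λ k → subst (_≤ bot) (sym (fk≡bot k)) ≤-refl)

module Ideals (em : ExcludedMiddle 0ℓ) (𝓘 : Set) (_≟_ : DecidableEquality 𝓘)
              (F : 𝓘 → Frame) where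
  open Sum 𝓘 _≟_ F
  open Frame
  private
    module FP (i : 𝓘) = FrameProperties (F i)

  tops bots : Elt
  tops i = top (F i)
  bots i = bot (F i)

  at : (j : 𝓘) → Carrier (F j) → B
  at j a = _*[_]_ {j} a j 𝟏

  ι : (j : 𝓘) → Carrier (F j) → Sub
  ι j a = _⊕[_]_ {j} a j 𝟏

  ⋀ι ⋁ι : Elt → Sub
  ⋀ι c = ⋀ᵢ (λ i → ι i (c i))
  ⋁ι c = ⋁ᵢ (λ i → ι i (c i))

  upd-same : ∀ j (a : Carrier (F j)) (u : Elt) → upd j a u j ≡ a
  upd-same j a u with j ≟ j
  ... | yes refl = refl
  ... | no j≢j   = ⊥-elim (j≢j refl)

  upd-other : ∀ j (a : Carrier (F j)) (u : Elt) {i} → ¬ i ≡ j → upd j a u i ≡ u i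
  upd-other j a u {i} i≢j with i ≟ j
  ... | yes refl = ⊥-elim (i≢j refl)
  ... | no _     = refl

  ≤-at⁺ : ∀ (v : B) j {a} → _≤_ (F j) (proj₁ v j) a → v ≤B at j a
  ≤-at⁺ v j vⱼ≤a i with i ≟ j
  ... | yes refl = vⱼ≤a
  ... | no _     = top-max (F i)

  ≤-at⁻ : ∀ (v : B) j {a} → v ≤B at j a → _≤_ (F j) (proj₁ v j) a
  ≤-at⁻ v j {a} v≤ = subst (_≤_ (F j) (proj₁ v j)) (upd-same j a tops) (v≤ j)

  at∈ι : ∀ j a → ι j a (at j a)
  at∈ι j a = inj₁ (lift λ i → ≤-refl (F i))

  ≐-sym : ∀ {X Y} → X ≐ Y → Y ≐ X
  ≐-sym (X⊆Y , Y⊆X) = Y⊆X , X⊆Y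

  ≐-trans : ∀ {X Y Z} → X ≐ Y → Y ≐ Z → X ≐ Z
  ≐-trans (X⊆Y , Y⊆X) (Y⊆Z , Z⊆Y) = (λ u x → Y⊆Z u (X⊆Y u x)) , (λ u z → Y⊆X u (Z⊆Y u z))

  Gen-ind : ∀ {S X} → IsCIdeal X → S ⊆ X → Gen S ⊆ X
  Gen-ind _ S⊆X u (base s) = S⊆X u s
  Gen-ind X-ideal@(down-closed , _) S⊆X u (down {v = v} u≤v g) =
    down-closed u v u≤v (Gen-ind X-ideal S⊆X v g)
  Gen-ind X-ideal@(_ , cover-closed) S⊆X _ (cover j a u g) =
    cover-closed j a u (λ k → Gen-ind X-ideal S⊆X _ (g k))

  Gen-isCIdeal : ∀ {S} → IsCIdeal (Gen S)
  Gen-isCIdeal = (λ u v u≤v g → down u≤v g) , (λ j → cover j)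

  Gen-bind : ∀ {S T} → S ⊆ Gen T → Gen S ⊆ Gen T
  Gen-bind = Gen-ind Gen-isCIdeal

  Gen-mono : ∀ {S T} → S ⊆ T → Gen S ⊆ Gen T
  Gen-mono S⊆T = Gen-bind (λ u s → base (S⊆T u s))

  ⊓-cong : ∀ {X X' Y Y'} → X ≐ X' → Y ≐ Y' → (X ⊓ Y) ≐ (X' ⊓ Y')
  ⊓-cong (X⊆X' , X'⊆X) (Y⊆Y' , Y'⊆Y) =
    (λ u (x , y) → X⊆X' u x , Y⊆Y' u y) , (λ u (x , y) → X'⊆X u x , Y'⊆Y u y)

  ⊔-cong : ∀ {X X' Y Y'} → X ≐ X' → Y ≐ Y' → (X ⊔ Y) ≐ (X' ⊔ Y')
  ⊔-cong (X⊆X' , X'⊆X) (Y⊆Y' , Y'⊆Y) =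
    Gen-mono (λ { u (inj₁ x) → inj₁ (X⊆X' u x) ; u (inj₂ y) → inj₂ (Y⊆Y' u y) }) ,
    Gen-mono (λ { u (inj₁ x) → inj₁ (X'⊆X u x) ; u (inj₂ y) → inj₂ (Y'⊆Y u y) })

  -- 0 is the empty join, so a vector with a zero coordinate is covered by nothing.
  𝐧⊆Gen : ∀ {S} → 𝐧 ⊆ Gen S
  𝐧⊆Gen u (lift (j , uⱼ≡0)) =
    down (≤-at⁺ u j (subst (λ z → _≤_ (F j) z _) (sym uⱼ≡0) (bot-min (F j))))
         (cover j {⊥} ⊥-elim 𝟏 λ ())

  ι-down : ∀ j a u v → u ≤B v → ι j a v → ι j a u
  ι-down j a u v u≤v (inj₁ (lift v≤)) = inj₁ (lift λ i → ≤-trans (F i) (u≤v i) (v≤ i))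
  ι-down j a u v u≤v (inj₂ (lift (i , vᵢ≡0))) =
    inj₂ (lift (i , FP.≤bot⇒≡bot i (subst (_≤_ (F i) (proj₁ u i)) vᵢ≡0 (u≤v i))))

  -- If u has a zero outside j' the covered vector lies in 𝐧. Otherwise every c k *_{j'} u
  -- lies below at j x or has c k = 0: for j' = j the join of the c k stays below x, and
  -- for j' ≠ j either u_j ≤ x or all c k, hence their join, vanish.
  ι-cover : ∀ j x j' {K : Set} (c : K → Carrier (F j')) (u : B) →
            (∀ k → ι j x (_*[_]_ {j'} (c k) j' u)) → ι j x (_*[_]_ {j'} (⋁ (F j') c) j' u)
  ι-cover j x j' c u ck∈ι with em {P = Σ[ i ∈ 𝓘 ] (¬ i ≡ j' × proj₁ u i ≡ bot (F i))}
  ... | yes (i , i≢j' , uᵢ≡0) = inj₂ (lift (i , trans (upd-other j' _ (proj₁ u) i≢j') uᵢ≡0))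
  ... | no no-zero-outside = by-coordinate (j' ≟ j)
    where
    w : B
    w = _*[_]_ {j'} (⋁ (F j') c) j' u

    _≤ⱼx : Carrier (F j) → Set
    y ≤ⱼx = _≤_ (F j) y x

    ck-below-or-zero : ∀ k → (upd j' (c k) (proj₁ u) j ≤ⱼx) ⊎ (c k ≡ bot (F j'))
    ck-below-or-zero k with ck∈ι k
    ... | inj₁ (lift le) = inj₁ (≤-at⁻ (_*[_]_ {j'} (c k) j' u) j le)
    ... | inj₂ (lift (i , e)) with i ≟ j'
    ...   | yes refl = inj₂ e
    ...   | no i≢j'  = ⊥-elim (no-zero-outside (i , i≢j' , e))

    by-coordinate : Dec (j' ≡ j) → ι j x w
    by-coordinate (yes refl) =
      inj₁ (lift (≤-at⁺ w j (subst _≤ⱼx (sym (upd-same j _ (proj₁ u))) (⋁-lub (F j) c ck≤x))))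
      where
      ck≤x : ∀ k → c k ≤ⱼx
      ck≤x k with ck-below-or-zero k
      ... | inj₁ le = subst _≤ⱼx (upd-same j (c k) (proj₁ u)) le
      ... | inj₂ e  = subst _≤ⱼx (sym e) (bot-min (F j))
    by-coordinate (no j'≢j) with em {P = proj₁ u j ≤ⱼx}
    ... | yes uⱼ≤x = inj₁ (lift (≤-at⁺ w j (subst _≤ⱼx (sym (upd-other j' _ (proj₁ u) (≢-sym j'≢j))) uⱼ≤x)))
    ... | no uⱼ≰x = inj₂ (lift (j' , trans (upd-same j' _ (proj₁ u)) (FP.⋁-bot j' c ck≡0)))
      where
      ck≡0 : ∀ k → c k ≡ bot (F j')
      ck≡0 k with ck-below-or-zero k
      ... | inj₁ le = ⊥-elim (uⱼ≰x (subst _≤ⱼx (upd-other j' (c k) (proj₁ u) (≢-sym j'≢j)) le))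
      ... | inj₂ e  = e

  ι-isCIdeal : ∀ j x → IsCIdeal (ι j x)
  ι-isCIdeal j x = ι-down j x , ι-cover j x

  Gen⊆ι : ∀ {S} j x → S ⊆ ι j x → Gen S ⊆ ι j x
  Gen⊆ι j x = Gen-ind (ι-isCIdeal j x)

  ι-mono : ∀ j {x y} → _≤_ (F j) x y → ι j x ⊆ ι j y
  ι-mono j x≤y u (inj₁ (lift u≤)) = inj₁ (lift (≤-at⁺ u j (≤-trans (F j) (≤-at⁻ u j u≤) x≤y)))
  ι-mono j x≤y u (inj₂ u∈𝐧) = inj₂ u∈𝐧

  ι-∧ : ∀ j x y → (ι j x ⊓ ι j y) ⊆ ι j (_∧_ (F j) x y)
  ι-∧ j x y u (inj₁ (lift u≤x) , inj₁ (lift u≤y)) =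
    inj₁ (lift (≤-at⁺ u j (∧-glb (F j) (≤-at⁻ u j u≤x) (≤-at⁻ u j u≤y))))
  ι-∧ j x y u (inj₂ u∈𝐧 , _)       = inj₂ u∈𝐧
  ι-∧ j x y u (inj₁ _ , inj₂ u∈𝐧) = inj₂ u∈𝐧

  ι-top : ∀ j → ι j (top (F j)) ≐ 𝟙
  ι-top j = (λ _ _ → lift _) , (λ u _ → inj₁ (lift (≤-at⁺ u j (top-max (F j)))))

  ι-bot : ∀ j → ι j (bot (F j)) ≐ 𝟘
  ι-bot j = (λ u u∈ι → 𝐧⊆Gen u (ι-bot⊆𝐧 u u∈ι)) , Gen⊆ι j (bot (F j)) (λ _ ())
    where
    ι-bot⊆𝐧 : ι j (bot (F j)) ⊆ 𝐧
    ι-bot⊆𝐧 u (inj₁ (lift u≤)) = lift (j , FP.≤bot⇒≡bot j (≤-at⁻ u j u≤))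
    ι-bot⊆𝐧 u (inj₂ u∈𝐧)     = u∈𝐧

  ⋀ι-tops : 𝟙 ≐ ⋀ι tops
  ⋀ι-tops = (λ u _ i → proj₂ (ι-top i) u _) , (λ _ _ → lift _)

  ⋁ι-bots : 𝟘 ≐ ⋁ι bots
  ⋁ι-bots = Gen-mono (λ _ ()) , Gen-bind (λ { u (i , u∈ι) → proj₁ (ι-bot i) u u∈ι })

  ⋀ι-upd : ∀ j a → ⋀ι (upd j a tops) ≐ ι j a
  ⋀ι-upd j a = (λ u u∈⋀ → subst (λ z → ι j z u) (upd-same j a tops) (u∈⋀ j)) , ⊇
    where
    ⊇ : ι j a ⊆ ⋀ι (upd j a tops)
    ⊇ u u∈ι i with i ≟ j
    ... | yes refl = u∈ι
    ... | no _     = proj₂ (ι-top i) u _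

  ⋁ι-upd : ∀ j a → ⋁ι (upd j a bots) ≐ ι j a
  ⋁ι-upd j a = Gen⊆ι j a (λ { u (i , u∈ι) → ⊆ u i u∈ι }) ,
               (λ u u∈ι → base (j , subst (λ z → ι j z u) (sym (upd-same j a bots)) u∈ι))
    where
    ⊆ : ∀ u i → ι i (upd j a bots i) u → ι j a u
    ⊆ u i u∈ι with i ≟ j
    ... | yes refl = u∈ι
    ... | no _     = Gen⊆ι j a (λ _ ()) u (proj₁ (ι-bot i) u u∈ι)

  ⋀ι-⊓ : ∀ c d → (⋀ι c ⊓ ⋀ι d) ≐ ⋀ι (λ i → _∧_ (F i) (c i) (d i))
  ⋀ι-⊓ c d = (λ u (u∈c , u∈d) i → ι-∧ i (c i) (d i) u (u∈c i , u∈d i)) ,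
             (λ u u∈ → (λ i → ι-mono i (∧-lb₁ (F i)) u (u∈ i)) ,
                       (λ i → ι-mono i (∧-lb₂ (F i)) u (u∈ i)))

  ⋁ι-mono : ∀ {c d} → (∀ i → _≤_ (F i) (c i) (d i)) → ⋁ι c ⊆ ⋁ι d
  ⋁ι-mono c≤d = Gen-mono (λ { u (i , u∈ι) → i , ι-mono i (c≤d i) u u∈ι })

  ⋁ι-⊔ : ∀ c d → (⋁ι c ⊔ ⋁ι d) ≐ ⋁ι (λ i → _∨_ (F i) (c i) (d i))
  ⋁ι-⊔ c d = Gen-bind (λ { u (inj₁ u∈c) → ⋁ι-mono (λ i → ⋁-ub (F i) _ true) u u∈c
                          ; u (inj₂ u∈d) → ⋁ι-mono (λ i → ⋁-ub (F i) _ false) u u∈d }) ,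
             Gen-bind (λ { u (i , inj₁ (lift u≤)) → down u≤ (cover i _ 𝟏 (covered i))
                         ; u (i , inj₂ u∈𝐧)       → 𝐧⊆Gen u u∈𝐧 })
    where
    covered : ∀ i b → (⋁ι c ⊔ ⋁ι d) (at i (if b then c i else d i))
    covered i true  = base (inj₁ (base (i , at∈ι i (c i))))
    covered i false = base (inj₂ (base (i , at∈ι i (d i))))

module Representation (em : ExcludedMiddle (lsuc 0ℓ)) (𝓘 : Set) (L : 𝓘 → DFrame) where
  open Coproduct 𝓘 (emDecEq em 𝓘) L
  open DecMembership (emDecEq em 𝓘) using (_∈?_)

  L₊ L₋ : 𝓘 → Frame
  L₊ i = DFrame.L₊ (L i)
  L₋ i = DFrame.L₋ (L i)

  module I₊ = Ideals (lowerExcludedMiddle em) 𝓘 (emDecEq em 𝓘) L₊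
  module I₋ = Ideals (lowerExcludedMiddle em) 𝓘 (emDecEq em 𝓘) L₋

  SupportedIn : List 𝓘 → (d₊ a₊ : ∀ i → C₊ i) (d₋ a₋ : ∀ i → C₋ i) → Set
  SupportedIn S d₊ a₊ d₋ a₋ = ∀ i → i ∉ S → (a₊ i ≡ d₊ i) × (a₋ i ≡ d₋ i)

  Supported : (d₊ a₊ : ∀ i → C₊ i) (d₋ a₋ : ∀ i → C₋ i) → Set
  Supported d₊ a₊ d₋ a₋ = Σ[ S ∈ List 𝓘 ] SupportedIn S d₊ a₊ d₋ a₋

  supported-default : ∀ {d₊ d₋} → Supported d₊ d₊ d₋ d₋
  supported-default = [] , λ _ _ → refl , refl

  supported-upd : ∀ {d₊ d₋} j a b → Supported d₊ (P.upd j a d₊) d₋ (N.upd j b d₋)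
  supported-upd j a b = j ∷ [] , λ i i∉ → let i≢j = λ e → i∉ (here e) in
    I₊.upd-other j a _ i≢j , I₋.upd-other j b _ i≢j

  supported-zip : ∀ {d₊ a₊ c₊ d₋ a₋ c₋}
                  (f₊ : ∀ i → C₊ i → C₊ i → C₊ i) (f₋ : ∀ i → C₋ i → C₋ i → C₋ i) →
                  (∀ i → f₊ i (d₊ i) (d₊ i) ≡ d₊ i) → (∀ i → f₋ i (d₋ i) (d₋ i) ≡ d₋ i) →
                  Supported d₊ a₊ d₋ a₋ → Supported d₊ c₊ d₋ c₋ →
                  Supported d₊ (λ i → f₊ i (a₊ i) (c₊ i)) d₋ (λ i → f₋ i (a₋ i) (c₋ i))
  supported-zip f₊ f₋ f₊-idem f₋-idem (S , a-supp) (T , c-supp) = S ++ T , supp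
    where
    supp : SupportedIn (S ++ T) _ _ _ _
    supp i i∉ with a-supp i (λ i∈ → i∉ (∈-++⁺ˡ i∈)) | c-supp i (λ i∈ → i∉ (∈-++⁺ʳ S i∈))
    ... | a₊≡ , a₋≡ | c₊≡ , c₋≡ =
      trans (cong₂ (f₊ i) a₊≡ c₊≡) (f₊-idem i) , trans (cong₂ (f₋ i) a₋≡ c₋≡) (f₋-idem i)

  supported⇒enumerable : ∀ {d₊ a₊ d₋ a₋} γ → (∀ i → inj i (d₊ i) (d₋ i) ≐ₚ γ) →
                         Supported d₊ a₊ d₋ a₋ →
                         Σ[ I ∈ List 𝓘 ] (∀ i → (i ∈ I) ⇔ (¬ (inj i (a₊ i) (a₋ i) ≐ₚ γ)))
  supported⇒enumerable {d₊} {a₊} {d₋} {a₋} γ default≐γ (S , supp) =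
    bounded⇒enumerable em (λ i → ¬ (inj i (a₊ i) (a₋ i) ≐ₚ γ)) S bounded
    where
    bounded : ∀ i → ¬ (inj i (a₊ i) (a₋ i) ≐ₚ γ) → i ∈ S
    bounded i ≉γ with i ∈? S
    ... | yes i∈S = i∈S
    ... | no i∉S  = let (a₊≡ , a₋≡) = supp i i∉S in
      ⊥-elim (≉γ (subst₂ (λ x y → inj i x y ≐ₚ γ) (sym a₊≡) (sym a₋≡) (default≐γ i)))

  upd-preserves : ∀ (R : Rel) {j a b d₊ d₋} → R j a b → (∀ i → R i (d₊ i) (d₋ i)) →
                  ∀ i → R i (P.upd j a d₊ i) (N.upd j b d₋ i)
  upd-preserves R {j} r rd i with emDecEq em 𝓘 i j
  ... | yes refl = r
  ... | no _     = rd i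

  module Meets (R : Rel) (R-tt : ∀ i → R i (I₊.tops i) (I₋.bots i))
               (R-∧ : ∀ i {a b c d} → R i a b → R i c d →
                      R i (Frame._∧_ (L₊ i) a c) (Frame._∨_ (L₋ i) b d)) where

    MeetForm : Pair → Set₁
    MeetForm α = Σ[ a₊ ∈ (∀ i → C₊ i) ] Σ[ a₋ ∈ (∀ i → C₋ i) ]
      (∀ i → R i (a₊ i) (a₋ i)) × (α ≐ₚ (I₊.⋀ι a₊ , I₋.⋁ι a₋)) × Supported I₊.tops a₊ I₋.bots a₋

    meetForm : ∀ {α} → R∧ R α → MeetForm α
    meetForm (one (mk j a b r)) =
      P.upd j a I₊.tops , N.upd j b I₋.bots , upd-preserves R r R-tt ,
      (I₊.≐-sym (I₊.⋀ι-upd j a) , I₋.≐-sym (I₋.⋁ι-upd j b)) , supported-upd j a b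
    meetForm tt = I₊.tops , I₋.bots , R-tt , (I₊.⋀ι-tops , I₋.⋁ι-bots) , supported-default
    meetForm (meet α∈ β∈) with meetForm α∈ | meetForm β∈
    ... | a₊ , a₋ , ra , (α₊≐ , α₋≐) , a-supp | c₊ , c₋ , rc , (β₊≐ , β₋≐) , c-supp =
      _ , _ , (λ i → R-∧ i (ra i) (rc i)) ,
      (I₊.≐-trans (I₊.⊓-cong α₊≐ β₊≐) (I₊.⋀ι-⊓ a₊ c₊) ,
       I₋.≐-trans (I₋.⊔-cong α₋≐ β₋≐) (I₋.⋁ι-⊔ a₋ c₋)) ,
      supported-zip (λ i → Frame._∧_ (L₊ i)) (λ i → Frame._∨_ (L₋ i))
                    (λ i → FrameProperties.top∧top (L₊ i)) (λ i → FrameProperties.bot∨bot (L₋ i))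
                    a-supp c-supp

    repMeet : ∀ α → R∧ R α → RepMeet R α
    repMeet α α∈ with meetForm α∈
    ... | a₊ , a₋ , r , α≐ , supp =
      a₊ , a₋ , r , α≐ , supported⇒enumerable ttₗ (λ i → I₊.ι-top i , I₋.ι-bot i) supp

  module Joins (R : Rel) (R-ff : ∀ i → R i (I₊.bots i) (I₋.tops i))
               (R-∨ : ∀ i {a b c d} → R i a b → R i c d →
                      R i (Frame._∨_ (L₊ i) a c) (Frame._∧_ (L₋ i) b d)) where

    JoinForm : Pair → Set₁
    JoinForm α = Σ[ a₊ ∈ (∀ i → C₊ i) ] Σ[ a₋ ∈ (∀ i → C₋ i) ]
      (∀ i → R i (a₊ i) (a₋ i)) × (α ≐ₚ (I₊.⋁ι a₊ , I₋.⋀ι a₋)) × Supported I₊.bots a₊ I₋.tops a₋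

    joinForm : ∀ {α} → R∨ R α → JoinForm α
    joinForm (one (mk j a b r)) =
      P.upd j a I₊.bots , N.upd j b I₋.tops , upd-preserves R r R-ff ,
      (I₊.≐-sym (I₊.⋁ι-upd j a) , I₋.≐-sym (I₋.⋀ι-upd j b)) , supported-upd j a b
    joinForm ff = I₊.bots , I₋.tops , R-ff , (I₊.⋁ι-bots , I₋.⋀ι-tops) , supported-default
    joinForm (join α∈ β∈) with joinForm α∈ | joinForm β∈
    ... | a₊ , a₋ , ra , (α₊≐ , α₋≐) , a-supp | c₊ , c₋ , rc , (β₊≐ , β₋≐) , c-supp =
      _ , _ , (λ i → R-∨ i (ra i) (rc i)) ,
      (I₊.≐-trans (I₊.⊔-cong α₊≐ β₊≐) (I₊.⋁ι-⊔ a₊ c₊) ,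
       I₋.≐-trans (I₋.⊓-cong α₋≐ β₋≐) (I₋.⋀ι-⊓ a₋ c₋)) ,
      supported-zip (λ i → Frame._∨_ (L₊ i)) (λ i → Frame._∧_ (L₋ i))
                    (λ i → FrameProperties.bot∨bot (L₊ i)) (λ i → FrameProperties.top∧top (L₋ i))
                    a-supp c-supp

    repJoin : ∀ α → R∨ R α → RepJoin R α
    repJoin α α∈ with joinForm α∈
    ... | a₊ , a₋ , r , α≐ , supp =
      a₊ , a₋ , r , α≐ , supported⇒enumerable ffₗ (λ i → I₊.ι-bot i , I₋.ι-top i) supp

lemma19 : (em : ExcludedMiddle (lsuc 0ℓ)) (𝓘 : Set) (L : 𝓘 → DFrame) →
    let open Coproduct 𝓘 (emDecEq em 𝓘) L in
      (∀ α → R∧ conR α → RepMeet conR α)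
      × (∀ α → R∧ totR α → RepMeet totR α)
      × (∀ α → R∨ conR α → RepJoin conR α)
      × (∀ α → R∨ totR α → RepJoin totR α)
lemma19 em 𝓘 L =
  Meets.repMeet conR (λ i → con-tt (L i)) (λ i → con-∧ (L i)) ,
  Meets.repMeet totR (λ i → tot-tt (L i)) (λ i → tot-∧ (L i)) ,
  Joins.repJoin conR (λ i → con-ff (L i)) (λ i → con-∨ (L i)) ,
  Joins.repJoin totR (λ i → tot-ff (L i)) (λ i → tot-∨ (L i))
  where
  open Representation em 𝓘 L
  open Coproduct 𝓘 (emDecEq em 𝓘) L using (conR; totR)
  open DFrame using (con-tt; con-ff; tot-tt; tot-ff; con-∧; con-∨; tot-∧; tot-∨)
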